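{- Let $\mathcal{G}_I$ be the class of all finite irreflexive graphs. (1) A downward closed class $\mathcal{C}\subseteq\mathcal{G}_I$ under the homomorphic image ordering is well quasi-ordered if and only if it is finite. (2) A class $\mathcal{C}=\mathrm{Av}(O_1,\dots,O_k)\subseteq\mathcal{G}_I$ defined by finitely many obstructions $O_1,\dots,O_k\in\mathcal{G}_I$, under either the homomorphic image ordering or the strong homomorphic image ordering, is never well quasi-ordered.
   Context: An irreflexive graph is a set with a symmetric binary edge relation containing no loops $(x,x)$. A homomorphism $\phi:G\to H$ maps edges to edges (so in irreflexive graphs adjacent vertices cannot be identified); it is strong if moreover every edge of $H$ between vertices of $\phi(G)$ is the image of an edge of $G$. Surjective (strong) homomorphisms are (strong) epimorphisms. Homomorphic image ordering: $A\preceq B$ iff there is an epimorphism $B\to A$; strong version: iff there is a strong epimorphism $B\to A$. A class is downward closed if $A\preceq B\in\mathcal{C}$ implies $A\in\mathcal{C}$. For a set $S$ of graphs, $\mathrm{Av}(S)$ is the set of all $G\in\mathcal{G}_I$ such that $O\not\preceq G$ for every $O\in S$. Well quasi-ordered means: no infinite strictly decreasing sequence and no infinite antichain. -}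

module Defs where

open import Data.Nat using (ℕ; suc)
open import Data.Fin using (Fin)
open import Data.Bool using (Bool; true; false)
open import Data.List using (List)
open import Data.List.Relation.Unary.Any using (Any)
open import Data.List.Relation.Unary.All using (All)
open import Data.Product using (Σ; _×_; ∃)
open import Relation.Nullary using (¬_)
open import Relation.Binary.PropositionalEquality using (_≡_; _≢_)

record Graph : Set where
  field
    size  : ℕ
    adj   : Fin size → Fin size → Bool
    sym   : ∀ x y → adj x y ≡ adj y x
    irrefl : ∀ x → adj x x ≡ false
open Graph public

E : (G : Graph) → Fin (size G) → Fin (size G) → Set
E G x y = adj G x y ≡ true

IsHom : (G H : Graph) → (Fin (size G) → Fin (size H)) → Set
IsHom G H f = ∀ x y → E G x y → E H (f x) (f y)

IsSurj : ∀ {n m} → (Fin n → Fin m) → Set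
IsSurj {n} {m} f = ∀ (y : Fin m) → ∃ λ x → f x ≡ y

IsStrong : (G H : Graph) → (Fin (size G) → Fin (size H)) → Set
IsStrong G H f = ∀ x y → E H (f x) (f y) →
  Σ (Fin (size G)) λ x' → Σ (Fin (size G)) λ y' → f x' ≡ f x × f y' ≡ f y × E G x' y'

Epi : Graph → Graph → Set
Epi G H = Σ (Fin (size G) → Fin (size H)) λ f → IsHom G H f × IsSurj f

StrongEpi : Graph → Graph → Set
StrongEpi G H = Σ (Fin (size G) → Fin (size H)) λ f → IsHom G H f × IsStrong G H f × IsSurj f

_≼_ : Graph → Graph → Set
A ≼ B = Epi B A

_≼ₛ_ : Graph → Graph → Set
A ≼ₛ B = StrongEpi B A

Iso : Graph → Graph → Set
Iso G H = Σ (Fin (size G) → Fin (size H)) λ f → Σ (Fin (size H) → Fin (size G)) λ g →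
  (∀ x → g (f x) ≡ x) × (∀ y → f (g y) ≡ y) × (∀ x y → adj H (f x) (f y) ≡ adj G x y)

Class : Set₁
Class = Graph → Set

Order : Set₁
Order = Graph → Graph → Set

DownwardClosed : Order → Class → Set
DownwardClosed R C = ∀ A B → R A B → C B → C A

FiniteClass : Class → Set
FiniteClass C = Σ (List Graph) λ L → ∀ G → C G → Any (Iso G) L

Strict : Order → Graph → Graph → Set
Strict R A B = R A B × ¬ R B A

WQO : Order → Class → Set
WQO R C =
  ¬ (Σ (ℕ → Graph) λ s → (∀ i → C (s i)) × (∀ i → Strict R (s (suc i)) (s i)))
  × ¬ (Σ (ℕ → Graph) λ s → (∀ i → C (s i)) × (∀ i j → i ≢ j → ¬ R (s i) (s j)))

Av : Order → List Graph → Class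
Av R Os G = All (λ O → ¬ R O G) Os

module Submission where

-- The whole theorem rests on the complete graphs K n.  A homomorphism out
-- of K n cannot identify two vertices (they are adjacent and graphs are
-- irreflexive), so K m ≼ K n forces m ≡ n: complete graphs of pairwise
-- distinct sizes form an infinite antichain, for ≼ and hence also for the
-- stronger order ≼ₛ.
--
-- Part (2): O ≼ K n forces n ≤ size O, so all K n with n beyond the sizes
-- of the obstructions lie in Av(O₁,…,Oₖ), which therefore contains an
-- infinite antichain.
--
-- Part (1), finite ⇒ WQO: by pigeonhole, any sequence in a class with
-- finitely many isomorphism types repeats a type, which rules out both
-- infinite descending chains and infinite antichains.
-- Part (1), WQO ⇒ finite (classically): there are only finitely many
-- graphs of each size up to isomorphism, so an infinite class has members
-- of every size beyond any bound; every G collapses onto K (size G), so a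
-- downward closed infinite class contains complete graphs of unboundedly
-- many sizes, i.e. an infinite antichain.

open import Defs
open import Level using (0ℓ)
open import Axiom.ExcludedMiddle using (ExcludedMiddle)
open import Data.Bool using (Bool; true; false; _∧_; not)
open import Data.Bool.Properties using (∧-comm; ∧-zeroʳ)
open import Data.Empty using (⊥; ⊥-elim)
open import Data.Fin as Fin using (Fin; toℕ; _≟_)
open import Data.Fin.Properties using (injective⇒≤; pigeonhole)
open import Data.List using (List; []; _∷_; [_]; _++_; map; length; lookup; cartesianProductWith)
open import Data.List.Relation.Unary.All using ([]; _∷_)
open import Data.List.Relation.Unary.Any as Any using (Any; here)
open import Data.List.Relation.Unary.Any.Properties using (lookup-index; ++⁺ˡ; ++⁺ʳ; map⁺; cartesianProductWith⁺)
open import Data.Nat as ℕ using (ℕ; zero; suc; _+_; _≤_; _<_; s≤s; _≤′_; ≤′-refl; ≤′-step)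
open import Data.Nat.Properties using (≤-trans; ≤-antisym; ≤⇒≤′; ≤∧≢⇒<; ≰⇒>; <⇒≢; <-trans; <-irrefl; <-cmp; m≤m+n; m≤n+m; n<1+n; +-cancelʳ-≡)
open import Data.Product using (_×_; _,_; proj₁; proj₂; Σ)
import Data.Vec.Functional as Vector
open import Function using (_∘_; id)
open import Function.Bundles using (_⇔_; mk⇔)
open import Relation.Binary.Definitions using (tri<; tri≈; tri>)
open import Relation.Binary.PropositionalEquality using (_≡_; _≢_; refl; trans; cong; cong₂; subst)
  renaming (sym to ≡-sym)
open import Relation.Nullary using (¬_; does; yes; no)
open import Relation.Nullary.Decidable using (decidable-stable)

-- The Boolean "x and y are different vertices", used to build adjacency
-- matrices that are automatically irreflexive.
distinct : ∀ {n} → Fin n → Fin n → Bool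
distinct x y = not (does (x ≟ y))

distinct-sym : ∀ {n} (x y : Fin n) → distinct x y ≡ distinct y x
distinct-sym x y with x ≟ y | y ≟ x
... | yes _    | yes _    = refl
... | no _     | no _     = refl
... | yes x≡y  | no y≢x   = ⊥-elim (y≢x (≡-sym x≡y))
... | no x≢y   | yes y≡x  = ⊥-elim (x≢y (≡-sym y≡x))

distinct-irrefl : ∀ {n} (x : Fin n) → distinct x x ≡ false
distinct-irrefl x with x ≟ x
... | yes _   = refl
... | no x≢x  = ⊥-elim (x≢x refl)

distinct-≢ : ∀ {n} {x y : Fin n} → x ≢ y → distinct x y ≡ true
distinct-≢ {x = x} {y} x≢y with x ≟ y
... | yes x≡y = ⊥-elim (x≢y x≡y)
... | no _    = refl

edge⇒≢ : ∀ G {x y} → E G x y → x ≢ y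
edge⇒≢ G {x} e refl with trans (≡-sym e) (irrefl G x)
... | ()

K : ℕ → Graph
K n = record
  { size   = n
  ; adj    = distinct
  ; sym    = distinct-sym
  ; irrefl = distinct-irrefl
  }

≼-refl : ∀ G → G ≼ G
≼-refl G = id , (λ _ _ e → e) , (λ y → y , refl)

≼-trans : ∀ A B C → A ≼ B → B ≼ C → A ≼ C
≼-trans A B C (f , f-hom , f-surj) (g , g-hom , g-surj) =
  f ∘ g , (λ x y e → f-hom _ _ (g-hom x y e)) , surj
  where
  surj : IsSurj (f ∘ g)
  surj a with f-surj a
  ... | b , fb≡a with g-surj b
  ...   | c , gc≡b = c , trans (cong f gc≡b) fb≡a

strong⇒≼ : ∀ A B → A ≼ₛ B → A ≼ B
strong⇒≼ A B (f , f-hom , _ , f-surj) = f , f-hom , f-surj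

iso⇒≽ : ∀ G H → Iso G H → H ≼ G
iso⇒≽ G H (f , g , gf , fg , pres) = f , (λ x y e → trans (pres x y) e) , (λ y → g y , fg y)

iso⇒≼ : ∀ G H → Iso G H → G ≼ H
iso⇒≼ G H (f , g , gf , fg , pres) = g , hom , (λ x → f x , gf x)
  where
  hom : IsHom H G g
  hom x y e = trans (≡-sym (pres (g x) (g y))) (trans (cong₂ (adj H) (fg x) (fg y)) e)

surjective⇒≤ : ∀ {n m} (f : Fin n → Fin m) → IsSurj f → m ≤ n
surjective⇒≤ f f-surj = injective⇒≤ {f = proj₁ ∘ f-surj} section-injective
  where
  section-injective : ∀ {a b} → proj₁ (f-surj a) ≡ proj₁ (f-surj b) → a ≡ b
  section-injective {a} {b} eq =
    trans (≡-sym (proj₂ (f-surj a))) (trans (cong f eq) (proj₂ (f-surj b)))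

-- A homomorphism out of K n is injective, hence n ≤ size H.
hom-from-K-≤ : ∀ {n} H (f : Fin n → Fin (size H)) → IsHom (K n) H f → n ≤ size H
hom-from-K-≤ {n} H f f-hom = injective⇒≤ {f = f} injective
  where
  injective : ∀ {x y} → f x ≡ f y → x ≡ y
  injective {x} {y} fx≡fy with x ≟ y
  ... | yes x≡y = x≡y
  ... | no x≢y  = ⊥-elim (edge⇒≢ H (f-hom x y (distinct-≢ x≢y)) fx≡fy)

K-≼-injective : ∀ {m n} → K m ≼ K n → m ≡ n
K-≼-injective {m} (f , f-hom , f-surj) = ≤-antisym (surjective⇒≤ f f-surj) (hom-from-K-≤ (K m) f f-hom)

K-≼-size : ∀ G → K (size G) ≼ G
K-≼-size G = id , (λ x y e → distinct-≢ (edge⇒≢ G e)) , (λ y → y , refl)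

complete-antichain-¬WQO : (R : Order) → (∀ A B → R A B → A ≼ B) →
  (C : Class) (n : ℕ → ℕ) → (∀ {i j} → i ≢ j → n i ≢ n j) →
  (∀ i → C (K (n i))) → ¬ WQO R C
complete-antichain-¬WQO R R⊆≼ C n n-inj inC (_ , no-antichain) =
  no-antichain (K ∘ n , inC , λ i j i≢j Kᵢ≼Kⱼ → n-inj i≢j (K-≼-injective (R⊆≼ (K (n i)) (K (n j)) Kᵢ≼Kⱼ)))

sizeBound : List Graph → ℕ
sizeBound []       = 0
sizeBound (O ∷ Os) = suc (size O) + sizeBound Os

K-avoids : (R : Order) → (∀ A B → R A B → A ≼ B) →
  ∀ Os n → sizeBound Os ≤ n → Av R Os (K n)
K-avoids R R⊆≼ []       n _     = []
K-avoids R R⊆≼ (O ∷ Os) n bound≤n = O⋠Kn ∷ K-avoids R R⊆≼ Os n (≤-trans (m≤n+m _ _) bound≤n)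
  where
  O⋠Kn : ¬ R O (K n)
  O⋠Kn O≼Kn with R⊆≼ O (K n) O≼Kn
  ... | f , f-hom , _ =
    <-irrefl refl (≤-trans (≤-trans (m≤m+n (suc (size O)) _) bound≤n) (hom-from-K-≤ O f f-hom))

Av-¬WQO : (R : Order) → (∀ A B → R A B → A ≼ B) → ∀ Os → ¬ WQO R (Av R Os)
Av-¬WQO R R⊆≼ Os = complete-antichain-¬WQO R R⊆≼ (Av R Os) (_+ N)
  (λ i≢j i+N≡j+N → i≢j (+-cancelʳ-≡ N _ _ i+N≡j+N))
  (λ i → K-avoids R R⊆≼ Os (i + N) (m≤n+m N i))
  where
  N = sizeBound Os

repeated-type : ∀ C → FiniteClass C → (s : ℕ → Graph) → (∀ i → C (s i)) →
  Σ ℕ λ i → Σ ℕ λ j → i < j × s i ≼ s j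
repeated-type C (reps , represented) s inC = same-type⇒≼ (pigeonhole (n<1+n (length reps)) type)
  where
  type : Fin (suc (length reps)) → Fin (length reps)
  type k = Any.index (represented (s (toℕ k)) (inC (toℕ k)))

  isoTo : ∀ k → Iso (s (toℕ k)) (lookup reps (type k))
  isoTo k = lookup-index (represented (s (toℕ k)) (inC (toℕ k)))

  same-type⇒≼ : (Σ _ λ i → Σ _ λ j → i Fin.< j × type i ≡ type j) →
    Σ ℕ λ i → Σ ℕ λ j → i < j × s i ≼ s j
  same-type⇒≼ (i , j , i<j , same-type) = toℕ i , toℕ j , i<j ,
    ≼-trans (s (toℕ i)) X (s (toℕ j)) (iso⇒≼ (s (toℕ i)) X (isoTo i))
      (iso⇒≽ (s (toℕ j)) X (subst (Iso (s (toℕ j)) ∘ lookup reps) (≡-sym same-type) (isoTo j)))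
    where
    X = lookup reps (type i)

descending-≼ : (s : ℕ → Graph) → (∀ k → s (suc k) ≼ s k) → ∀ {i j} → i ≤′ j → s j ≼ s i
descending-≼ s step {i} ≤′-refl          = ≼-refl (s i)
descending-≼ s step {i} (≤′-step {j} i≤j) = ≼-trans (s (suc j)) (s j) (s i) (step j) (descending-≼ s step i≤j)

finite⇒WQO : ∀ C → FiniteClass C → WQO _≼_ C
finite⇒WQO C fin = no-descending , no-antichain
  where
  no-descending : ¬ (Σ (ℕ → Graph) λ s → (∀ i → C (s i)) × (∀ i → Strict _≼_ (s (suc i)) (s i)))
  no-descending (s , inC , strict) with repeated-type C fin s inC
  ... | i , j , i<j , sᵢ≼sⱼ =
    proj₂ (strict i) (≼-trans (s i) (s j) (s (suc i)) sᵢ≼sⱼ (descending-≼ s (proj₁ ∘ strict) (≤⇒≤′ i<j)))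

  no-antichain : ¬ (Σ (ℕ → Graph) λ s → (∀ i → C (s i)) × (∀ i j → i ≢ j → ¬ s i ≼ s j))
  no-antichain (s , inC , incomparable) with repeated-type C fin s inC
  ... | i , j , i<j , sᵢ≼sⱼ = incomparable i j (<⇒≢ i<j) sᵢ≼sⱼ

functions : ∀ {B : Set} → List B → (k : ℕ) → List (Fin k → B)
functions xs zero    = [ (λ ()) ]
functions xs (suc k) = cartesianProductWith Vector._∷_ xs (functions xs k)

functions-cover : ∀ {B : Set} (xs : List B) (R : B → B → Set) → (∀ b → Any (R b) xs) →
  ∀ k (f : Fin k → B) → Any (λ g → ∀ x → R (f x) (g x)) (functions xs k)
functions-cover xs R cover zero    f = here (λ ())
functions-cover xs R cover (suc k) f =
  cartesianProductWith⁺ Vector._∷_ (λ r rs → λ { Fin.zero → r ; (Fin.suc x) → rs x })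
    (cover (f Fin.zero)) (functions-cover xs R cover k (f ∘ Fin.suc))

booleans-cover : ∀ b → Any (b ≡_) (true ∷ false ∷ [])
booleans-cover true  = here refl
booleans-cover false = Any.there (here refl)

matrices : (n : ℕ) → List (Fin n → Fin n → Bool)
matrices n = functions (functions (true ∷ false ∷ []) n) n

matrices-cover : ∀ n (a : Fin n → Fin n → Bool) → Any (λ b → ∀ x y → a x y ≡ b x y) (matrices n)
matrices-cover n = functions-cover _ (λ r r′ → ∀ y → r y ≡ r′ y)
  (functions-cover _ _≡_ booleans-cover n) n

matrixGraph : ∀ {n} → (Fin n → Fin n → Bool) → Graph
matrixGraph {n} a = record
  { size   = n
  ; adj    = λ x y → (a x y ∧ a y x) ∧ distinct x y
  ; sym    = λ x y → cong₂ _∧_ (∧-comm (a x y) (a y x)) (distinct-sym x y)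
  ; irrefl = λ x → trans (cong ((a x x ∧ a x x) ∧_) (distinct-irrefl x)) (∧-zeroʳ _)
  }

adj-symmetrised : ∀ G x y → (adj G x y ∧ adj G y x) ∧ distinct x y ≡ adj G x y
adj-symmetrised G x y with x ≟ y
... | yes refl = trans (∧-zeroʳ _) (≡-sym (irrefl G x))
... | no _ rewrite Graph.sym G y x with adj G x y
...   | true  = refl
...   | false = refl

graphsOfSize : ℕ → List Graph
graphsOfSize n = map matrixGraph (matrices n)

graphsOfSize-cover : ∀ G → Any (Iso G) (graphsOfSize (size G))
graphsOfSize-cover G = map⁺ (Any.map same-adjacency (matrices-cover (size G) (adj G)))
  where
  same-adjacency : ∀ {b} → (∀ x y → adj G x y ≡ b x y) → Iso G (matrixGraph b)
  same-adjacency adj≡b = id , id , (λ _ → refl) , (λ _ → refl) , λ x y →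
    trans (cong₂ (λ p q → (p ∧ q) ∧ distinct x y) (≡-sym (adj≡b x y)) (≡-sym (adj≡b y x)))
          (adj-symmetrised G x y)

graphsBelow : ℕ → List Graph
graphsBelow zero    = []
graphsBelow (suc N) = graphsOfSize N ++ graphsBelow N

graphsBelow-cover : ∀ N G → size G < N → Any (Iso G) (graphsBelow N)
graphsBelow-cover (suc N) G (s≤s size≤N) with size G ℕ.≟ N
... | yes refl    = ++⁺ˡ (graphsOfSize-cover G)
... | no size≢N  = ++⁺ʳ (graphsOfSize N) (graphsBelow-cover N G (≤∧≢⇒< size≤N size≢N))

increasing⇒monotone : (n : ℕ → ℕ) → (∀ i → n i < n (suc i)) → ∀ {i j} → suc i ≤′ j → n i < n j
increasing⇒monotone n step {i} ≤′-refl        = step i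
increasing⇒monotone n step (≤′-step {j} i<j) = <-trans (increasing⇒monotone n step i<j) (step j)

increasing⇒injective : (n : ℕ → ℕ) → (∀ i → n i < n (suc i)) → ∀ {i j} → i ≢ j → n i ≢ n j
increasing⇒injective n step {i} {j} i≢j with <-cmp i j
... | tri< i<j _ _ = <⇒≢ (increasing⇒monotone n step (≤⇒≤′ i<j))
... | tri≈ _ i≡j _ = ⊥-elim (i≢j i≡j)
... | tri> _ _ j<i = <⇒≢ (increasing⇒monotone n step (≤⇒≤′ j<i)) ∘ ≡-sym

WQO⇒finite : ExcludedMiddle 0ℓ → ∀ C → DownwardClosed _≼_ C → WQO _≼_ C → FiniteClass C
WQO⇒finite lem C down wqo = decidable-stable lem infinite-contradicts-WQO
  where
  module _ (infinite : ¬ FiniteClass C) where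
    large-complete : ∀ N → Σ ℕ λ m → N ≤ m × C (K m)
    large-complete N = decidable-stable lem λ none → infinite (graphsBelow N , λ G G∈C →
      graphsBelow-cover N G (≰⇒> λ N≤size → none (size G , N≤size , down _ G (K-≼-size G) G∈C)))

    sizes : ℕ → ℕ
    sizes zero    = proj₁ (large-complete 0)
    sizes (suc i) = proj₁ (large-complete (suc (sizes i)))

    sizes-in-C : ∀ i → C (K (sizes i))
    sizes-in-C zero    = proj₂ (proj₂ (large-complete 0))
    sizes-in-C (suc i) = proj₂ (proj₂ (large-complete (suc (sizes i))))

    infinite-contradicts-WQO : ⊥
    infinite-contradicts-WQO = complete-antichain-¬WQO _≼_ (λ _ _ → id) C sizes
      (increasing⇒injective sizes (λ i → proj₁ (proj₂ (large-complete (suc (sizes i))))))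
      sizes-in-C wqo

theorem3p1 : ExcludedMiddle 0ℓ →
    ((C : Class) → DownwardClosed _≼_ C → (WQO _≼_ C ⇔ FiniteClass C))
    × ((Os : List Graph) → ¬ WQO _≼_ (Av _≼_ Os) × ¬ WQO _≼ₛ_ (Av _≼ₛ_ Os))
theorem3p1 lem =
  (λ C down → mk⇔ (WQO⇒finite lem C down) (finite⇒WQO C)) ,
  (λ Os → Av-¬WQO _≼_ (λ _ _ → id) Os , Av-¬WQO _≼ₛ_ strong⇒≼ Os)
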